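{- Let $p$ be an odd prime. Then there exist an IMRS$^*_{(\mathbb{Z}_{4p}\oplus\mathbb{Z}_8)\setminus(\mathbb{Z}_{4p}\oplus\{0,4\})}(p,4;6)$ and an MRS$^*_{\mathbb{Z}_{4p}\oplus\mathbb{Z}_8}(p,4;8)$.
   Context: $\mathbb{Z}_v$ denotes the additive group of integers modulo $v$; $\{0,4\}$ denotes the subgroup of order $2$ of $\mathbb{Z}_8$. For a finite abelian group $(K,+)$ and a subset $T\subseteq K$ with $|T|=xyz$, an IMRS$^*_{T}(x,y;z)$ is a collection of $z$ arrays of size $x\times y$ whose entries are elements of $T$, each element of $T$ appearing exactly once among all the arrays, such that every row sum and every column sum in every array equals $0\in K$. An MRS$^*_K(x,y;z)$ is the same notion with $T=K$. -}

module Defs where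

open import Data.Nat using (ℕ; _+_)
import Data.Nat as ℕ
open import Data.Nat.Divisibility using (_∣_)
open import Data.Fin using (Fin; toℕ; zero; suc)
open import Data.Unit using (⊤)
open import Data.Product using (_×_; _,_; proj₁; proj₂; Σ; ∃)
open import Relation.Binary.PropositionalEquality using (_≡_; _≢_)
open import Function.Definitions using (Injective)

Grp : ℕ → ℕ → Set
Grp m n = Fin m × Fin n

ΣF : {k : ℕ} → (Fin k → ℕ) → ℕ
ΣF {ℕ.zero}  f = 0
ΣF {ℕ.suc k} f = f zero + ΣF (λ i → f (suc i))

SumsToZero : {m n k : ℕ} → (Fin k → Grp m n) → Set
SumsToZero {m} {n} f =
  (m ∣ ΣF (λ i → toℕ (proj₁ (f i)))) × (n ∣ ΣF (λ i → toℕ (proj₂ (f i))))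

-- Triple index (array number, row, column).
Cell : ℕ → ℕ → ℕ → Set
Cell x y z = Fin z × Fin x × Fin y

-- IMRS*_T(x,y;z) in K = Z_m ⊕ Z_n: z arrays of size x × y (array k has
-- entry A k i j in row i, column j), every element of T appearing exactly
-- once among all arrays (the entry map is a bijection onto T), and every
-- row sum and column sum equal to 0 in K.
IsIMRS : (m n : ℕ) (T : Grp m n → Set) (x y z : ℕ)
         (A : Fin z → Fin x → Fin y → Grp m n) → Set
IsIMRS m n T x y z A =
  ((k : Fin z) (i : Fin x) (j : Fin y) → T (A k i j))
  × Injective _≡_ _≡_ (λ (c : Cell x y z) → A (proj₁ c) (proj₁ (proj₂ c)) (proj₂ (proj₂ c)))
  × ((t : Grp m n) → T t → Σ (Cell x y z) λ c → A (proj₁ c) (proj₁ (proj₂ c)) (proj₂ (proj₂ c)) ≡ t)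
  × ((k : Fin z) (i : Fin x) → SumsToZero (λ j → A k i j))
  × ((k : Fin z) (j : Fin y) → SumsToZero (λ i → A k i j))

IMRS : (m n : ℕ) (T : Grp m n → Set) (x y z : ℕ) → Set
IMRS m n T x y z = Σ (Fin z → Fin x → Fin y → Grp m n) (IsIMRS m n T x y z)

Whole : {m n : ℕ} → Grp m n → Set
Whole _ = ⊤

MRS : (m n : ℕ) (x y z : ℕ) → Set
MRS m n x y z = IMRS m n Whole x y z

NotIn04 : {m : ℕ} → Grp m 8 → Set
NotIn04 (a , b) = (toℕ b ≢ 0) × (toℕ b ≢ 4)

{-# OPTIONS --safe #-}
module Submission where

open import Defs
open import Data.Nat using (ℕ; _*_)
open import Data.Nat.Primality using (Prime)
open import Data.Nat.Divisibility using (_∣_)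
open import Data.Product using (_×_)
open import Relation.Nullary using (¬_)

open import Algebra.Definitions using (Involutive)
open import Data.Bool using (Bool; true; false)
open import Data.Empty using (⊥-elim)
open import Data.Fin using (Fin; zero; suc; toℕ; #_; combine; _↑ˡ_; _↑ʳ_; splitAt; join; opposite)
open import Data.Fin.Permutation using (reverse)
open import Data.Fin.Properties
  using (_≟_; all?; any?; toℕ<n; toℕ-↑ˡ; toℕ-↑ʳ; splitAt-↑ˡ; splitAt-↑ʳ; join-splitAt;
         toℕ-combine; combine-injective; combine-surjective; opposite-prop; opposite-involutive)
import Data.Nat as ℕ
open import Data.Nat using (zero; suc; _+_; _∸_)
open import Data.Nat.Divisibility using (_∣?_; _∣0; ∣-refl; ∣m∣n⇒∣m+n; *-monoˡ-∣)
open import Data.Nat.Primality using (¬prime[1])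
open import Data.Nat.Properties
  using (+-assoc; +-comm; +-suc; *-identityˡ; m+[n∸m]≡n; +-0-commutativeMonoid)
open import Data.Nat.Tactic.RingSolver using (solve-∀)
open import Algebra.Properties.CommutativeMonoid.Sum +-0-commutativeMonoid
  using (sum; sum-permute; ∑-distrib-+)
open import Data.Product using (_,_; proj₁; proj₂; Σ; ∃-syntax)
open import Data.Product.Properties using (≡-dec)
open import Data.Sum using (_⊎_; inj₁; inj₂; [_,_]′)
open import Data.Unit using (⊤; tt)
open import Data.Vec using (Vec; []; _∷_; lookup)
open import Function using (_∘_)
open import Function.Definitions using (Injective)
open import Relation.Binary.Definitions using (DecidableEquality)
open import Relation.Binary.PropositionalEquality
open import Relation.Nullary using (Dec; yes)
open import Relation.Nullary.Decidable using (True; toWitness; map′; _×-dec_; _→-dec_; ¬?)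

-- Write p = 2n + 1 and an element of ℤ_4p as p x + y with x ∈ ℤ_4 and 0 ≤ y < p. In every array,
-- row y has the entries (p x + y, b) in its first two columns and (p x + y′, b) in its last two,
-- where y′ ≡ -y is read in [0, p) and (x, b) ∈ ℤ_4 ⊕ ℤ_8 is taken from a small seed that depends
-- only on the array, the column and the class of y among {0}, {1}, {-1}, {2, …, n}, {-2, …, -n}.
-- As y + y′ = p for y ≠ 0, the second summands of a row add up to 0 or 2p, and those of the rows
-- y and -y to p in each column, so all line sums vanish once the seed satisfies a few congruences
-- modulo 4 and 8; every element of the target set occurs exactly once as soon as, for each class,
-- the seed entries that meet a residue of that class form a bijection onto the allowed part of
-- ℤ_4 ⊕ ℤ_8. The two seeds, with 6 and 8 arrays, are checked by evaluation.

ΣF-cong : ∀ {k} {f g : Fin k → ℕ} → (∀ i → f i ≡ g i) → ΣF f ≡ ΣF g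
ΣF-cong {zero}  f≗g = refl
ΣF-cong {suc k} f≗g = cong₂ _+_ (f≗g zero) (ΣF-cong (f≗g ∘ suc))

ΣF≡sum : ∀ {k} (f : Fin k → ℕ) → ΣF f ≡ sum f
ΣF≡sum {zero}  f = refl
ΣF≡sum {suc k} f = cong (f zero +_) (ΣF≡sum (f ∘ suc))

ΣF-↑ : ∀ {a b} (f : Fin (a + b) → ℕ) →
       ΣF f ≡ ΣF (λ i → f (i ↑ˡ b)) + ΣF (λ j → f (a ↑ʳ j))
ΣF-↑ {zero}  f = refl
ΣF-↑ {suc a} {b} f = trans (cong (f zero +_) (ΣF-↑ {a} {b} (f ∘ suc))) (sym (+-assoc (f zero) _ _))

ΣF-opposite : ∀ {k} (f : Fin k → ℕ) → ΣF f ≡ ΣF (f ∘ opposite)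
ΣF-opposite {k} f = begin
  ΣF f                ≡⟨ ΣF≡sum f ⟩
  sum f               ≡⟨ sum-permute f (reverse {k}) ⟩
  sum (f ∘ opposite)  ≡⟨ ΣF≡sum (f ∘ opposite) ⟨
  ΣF (f ∘ opposite)   ∎
  where open ≡-Reasoning

ΣF-+ : ∀ {k} (f g : Fin k → ℕ) → ΣF (λ i → f i + g i) ≡ ΣF f + ΣF g
ΣF-+ f g = begin
  ΣF (λ i → f i + g i)  ≡⟨ ΣF≡sum (λ i → f i + g i) ⟩
  sum (λ i → f i + g i) ≡⟨ ∑-distrib-+ f g ⟩
  sum f + sum g         ≡⟨ cong₂ _+_ (ΣF≡sum f) (ΣF≡sum g) ⟨
  ΣF f + ΣF g           ∎
  where open ≡-Reasoning

∣-ΣF : ∀ {d k} {f : Fin k → ℕ} → (∀ i → d ∣ f i) → d ∣ ΣF f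
∣-ΣF {d} {zero}  d∣f = d ∣0
∣-ΣF {d} {suc k} d∣f = ∣m∣n⇒∣m+n (d∣f zero) (∣-ΣF (d∣f ∘ suc))

-- plus i and minus i stand for the residues i + 1 and -(i + 1) of ℤ_(2n+1).
data Label (n : ℕ) : Set where
  origin     : Label n
  plus minus : Fin n → Label n

module _ {n : ℕ} where

  residue : Label n → Fin (suc (n + n))
  residue origin    = zero
  residue (plus i)  = suc (i ↑ˡ n)
  residue (minus i) = suc (n ↑ʳ opposite i)

  fromSplit : Fin n ⊎ Fin n → Label n
  fromSplit = [ plus , minus ∘ opposite ]′

  label : Fin (suc (n + n)) → Label n
  label zero    = origin
  label (suc y) = fromSplit (splitAt n y)

  label-residue : ∀ l → label (residue l) ≡ l
  label-residue origin    = refl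
  label-residue (plus i)  = cong fromSplit (splitAt-↑ˡ n i n)
  label-residue (minus i) =
    trans (cong fromSplit (splitAt-↑ʳ n n (opposite i))) (cong minus (opposite-involutive i))

  residue-fromSplit : ∀ s → residue (fromSplit s) ≡ suc (join n n s)
  residue-fromSplit (inj₁ i) = refl
  residue-fromSplit (inj₂ j) = cong (λ i → suc (n ↑ʳ i)) (opposite-involutive j)

  residue-label : ∀ y → residue (label y) ≡ y
  residue-label zero    = refl
  residue-label (suc y) = trans (residue-fromSplit (splitAt n y)) (cong suc (join-splitAt n n y))

  residue-injective : Injective _≡_ _≡_ residue
  residue-injective {l} {l′} eq = trans (sym (label-residue l)) (trans (cong label eq) (label-residue l′))

  label-injective : Injective _≡_ _≡_ label
  label-injective {y} {y′} eq = trans (sym (residue-label y)) (trans (cong residue eq) (residue-label y′))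

  residue-plus-minus : ∀ i → toℕ (residue (plus i)) + toℕ (residue (minus i)) ≡ suc (n + n)
  residue-plus-minus i = begin
    toℕ (residue (plus i)) + toℕ (residue (minus i))
      ≡⟨ cong₂ (λ u v → suc u + suc v) (toℕ-↑ˡ i n)
               (trans (toℕ-↑ʳ n (opposite i)) (cong (n +_) (opposite-prop i))) ⟩
    suc (toℕ i) + suc (n + (n ∸ suc (toℕ i)))
      ≡⟨ swap-middle (toℕ i) n (n ∸ suc (toℕ i)) ⟩
    suc (n + (suc (toℕ i) + (n ∸ suc (toℕ i))))
      ≡⟨ cong (λ t → suc (n + t)) (m+[n∸m]≡n (toℕ<n i)) ⟩
    suc (n + n) ∎
    where
    open ≡-Reasoning
    swap-middle : ∀ a b c → suc a + suc (b + c) ≡ suc (b + (suc a + c))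
    swap-middle = solve-∀

  residue-minus-plus : ∀ i → toℕ (residue (minus i)) + toℕ (residue (plus i)) ≡ suc (n + n)
  residue-minus-plus i = trans (+-comm (toℕ (residue (minus i))) _) (residue-plus-minus i)

  ΣF-pairs : (F : Label n → ℕ) →
             ΣF (F ∘ label) ≡ F origin + ΣF (λ i → F (plus i) + F (minus i))
  ΣF-pairs F = cong (F origin +_) (begin
    ΣF (λ y → F (label (suc y)))
      ≡⟨ ΣF-↑ {n} {n} (λ y → F (label (suc y))) ⟩
    ΣF (λ i → F (label (residue (plus i)))) + ΣF (λ j → F (label (suc (n ↑ʳ j))))
      ≡⟨ cong (ΣF (λ i → F (label (residue (plus i)))) +_) (ΣF-opposite (λ j → F (label (suc (n ↑ʳ j))))) ⟩
    ΣF (λ i → F (label (residue (plus i)))) + ΣF (λ i → F (label (residue (minus i))))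
      ≡⟨ cong₂ _+_ (ΣF-cong (cong F ∘ label-residue ∘ plus)) (ΣF-cong (cong F ∘ label-residue ∘ minus)) ⟩
    ΣF (F ∘ plus) + ΣF (F ∘ minus)
      ≡⟨ ΣF-+ (F ∘ plus) (F ∘ minus) ⟨
    ΣF (λ i → F (plus i) + F (minus i)) ∎)
    where open ≡-Reasoning

column-sum-∣ : ∀ {m d} (F : Label (suc m) → ℕ) →
               d ∣ F origin + (F (plus zero) + F (minus zero)) →
               (∀ i → d ∣ F (plus (suc i)) + F (minus (suc i))) →
               d ∣ ΣF (F ∘ label)
column-sum-∣ {d = d} F d∣first d∣rest =
  subst (d ∣_) (sym (trans (ΣF-pairs F) (sym (+-assoc (F origin) _ _))))
    (∣m∣n⇒∣m+n d∣first (∣-ΣF d∣rest))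

data Class : Set where
  c0 c1 c-1 c+ c- : Class

module _ {n : ℕ} where

  class : Label n → Class
  class origin          = c0
  class (plus zero)     = c1
  class (plus (suc _))  = c+
  class (minus zero)    = c-1
  class (minus (suc _)) = c-

  negate : Label n → Label n
  negate origin    = origin
  negate (plus i)  = minus i
  negate (minus i) = plus i

negateᶜ : Class → Class
negateᶜ c0  = c0
negateᶜ c1  = c-1
negateᶜ c-1 = c1
negateᶜ c+  = c-
negateᶜ c-  = c+

negate-involutive : ∀ {n} → Involutive _≡_ (negate {n})
negate-involutive origin    = refl
negate-involutive (plus i)  = refl
negate-involutive (minus i) = refl

negateᶜ-involutive : Involutive _≡_ negateᶜ
negateᶜ-involutive c0  = refl
negateᶜ-involutive c1  = refl
negateᶜ-involutive c-1 = refl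
negateᶜ-involutive c+  = refl
negateᶜ-involutive c-  = refl

class-negate : ∀ {n} (l : Label n) → class (negate l) ≡ negateᶜ (class l)
class-negate origin          = refl
class-negate (plus zero)     = refl
class-negate (plus (suc _))  = refl
class-negate (minus zero)    = refl
class-negate (minus (suc _)) = refl

carry : Class → ℕ
carry c0 = 0
carry _  = 1

residue-+-negate : ∀ {n} (l : Label n) →
                   toℕ (residue l) + toℕ (residue (negate l)) ≡ carry (class l) * suc (n + n)
residue-+-negate origin          = refl
residue-+-negate (plus zero)     = trans (residue-plus-minus zero) (sym (*-identityˡ _))
residue-+-negate (plus (suc i))  = trans (residue-plus-minus (suc i)) (sym (*-identityˡ _))
residue-+-negate (minus zero)    = trans (residue-minus-plus zero) (sym (*-identityˡ _))
residue-+-negate (minus (suc i)) = trans (residue-minus-plus (suc i)) (sym (*-identityˡ _))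

negatedColumn : Fin 4 → Bool
negatedColumn zero          = false
negatedColumn (suc zero)    = false
negatedColumn (suc (suc _)) = true

negateIf : ∀ {n} → Bool → Label n → Label n
negateIf false l = l
negateIf true  l = negate l

negateIfᶜ : Bool → Class → Class
negateIfᶜ false t = t
negateIfᶜ true  t = negateᶜ t

negateIf-involutive : ∀ {n} b → Involutive _≡_ (negateIf {n} b)
negateIf-involutive false l = refl
negateIf-involutive true  l = negate-involutive l

negateIfᶜ-involutive : ∀ b → Involutive _≡_ (negateIfᶜ b)
negateIfᶜ-involutive false t = refl
negateIfᶜ-involutive true  t = negateᶜ-involutive t

negateIf-injective : ∀ {n} b → Injective _≡_ _≡_ (negateIf {n} b)
negateIf-injective b {l} {l′} eq =
  trans (sym (negateIf-involutive b l)) (trans (cong (negateIf b) eq) (negateIf-involutive b l′))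

class-negateIf : ∀ {n} b (l : Label n) → class (negateIf b l) ≡ negateIfᶜ b (class l)
class-negateIf false l = refl
class-negateIf true  l = class-negate l

negateIf-origin : ∀ {n} b → negateIf {n} b origin ≡ origin
negateIf-origin false = refl
negateIf-origin true  = refl

residue-negateIf-pair : ∀ {n} b (i : Fin n) →
  toℕ (residue (negateIf b (plus i))) + toℕ (residue (negateIf b (minus i))) ≡ suc (n + n)
residue-negateIf-pair false i = residue-plus-minus i
residue-negateIf-pair true  i = residue-minus-plus i

∣-scale : ∀ {d s t} p → d ∣ s → t ≡ s * p → d * p ∣ t
∣-scale {d} p d∣s t≡s*p = subst (d * p ∣_) (sym t≡s*p) (*-monoˡ-∣ p d∣s)

pair-sum : ∀ {p a a′} x x′ → a + a′ ≡ p → (p * x + a) + (p * x′ + a′) ≡ (x + (x′ + 1)) * p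
pair-sum {a = a} {a′} x x′ refl = identity a a′ x x′
  where
  identity : ∀ a a′ x x′ →
    ((a + a′) * x + a) + ((a + a′) * x′ + a′) ≡ (x + (x′ + 1)) * (a + a′)
  identity = solve-∀

origin-pair-sum : ∀ {p a a′} x₀ x x′ → a + a′ ≡ p →
  (p * x₀ + 0) + ((p * x + a) + (p * x′ + a′)) ≡ (x₀ + (x + (x′ + 1))) * p
origin-pair-sum {p} x₀ x x′ a+a′≡p = trans (cong (p * x₀ + 0 +_) (pair-sum x x′ a+a′≡p)) (identity p x₀ _)
  where
  identity : ∀ p x₀ s → (p * x₀ + 0) + s * p ≡ (x₀ + s) * p
  identity = solve-∀

row-sum-∣ : ∀ {n} (l : Label n) (x : Fin 4 → ℕ) → 4 ∣ ΣF x + 2 * carry (class l) →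
            4 * suc (n + n) ∣ ΣF (λ c → suc (n + n) * x c + toℕ (residue (negateIf (negatedColumn c) l)))
row-sum-∣ {n} l x 4∣ = ∣-scale p 4∣ (begin
  (p * x₀ + a) + ((p * x₁ + a) + ((p * x₂ + a′) + ((p * x₃ + a′) + 0)))
    ≡⟨ collect p x₀ x₁ x₂ x₃ a a′ ⟩
  ΣF x * p + 2 * (a + a′)
    ≡⟨ cong (λ t → ΣF x * p + 2 * t) (residue-+-negate l) ⟩
  ΣF x * p + 2 * (carry (class l) * p)
    ≡⟨ factor (ΣF x) (carry (class l)) p ⟩
  (ΣF x + 2 * carry (class l)) * p ∎)
  where
  open ≡-Reasoning
  p = suc (n + n)
  a = toℕ (residue l)
  a′ = toℕ (residue (negate l))
  x₀ = x zero
  x₁ = x (suc zero)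
  x₂ = x (suc (suc zero))
  x₃ = x (suc (suc (suc zero)))
  collect : ∀ p x₀ x₁ x₂ x₃ a a′ →
    (p * x₀ + a) + ((p * x₁ + a) + ((p * x₂ + a′) + ((p * x₃ + a′) + 0)))
      ≡ (x₀ + (x₁ + (x₂ + (x₃ + 0)))) * p + 2 * (a + a′)
  collect = solve-∀
  factor : ∀ s w p → s * p + 2 * (w * p) ≡ (s + 2 * w) * p
  factor = solve-∀

Seed : ℕ → Set
Seed z = Class → Fin z → Fin 4 → Fin 4 × Fin 8

module _ {z : ℕ} (e : Seed z) where

  xcoord bcoord : Class → Fin z → Fin 4 → ℕ
  xcoord t k c = toℕ (proj₁ (e t k c))
  bcoord t k c = toℕ (proj₂ (e t k c))

  -- The entries met by the residues of class s: column c of array k shows such a residue in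
  -- a row of class s or -s according as the column keeps or negates the row residue.
  cover : Class → Fin z × Fin 4 → Fin 4 × Fin 8
  cover s (k , c) = e (negateIfᶜ (negatedColumn c) s) k c

-- In row-x and column-x, the terms 2 * carry t and 1 count the multiples of p contributed by the
-- residues of a row and by those of a pair of rows l, -l in a column.
record IsSeed {z : ℕ} (Allowed : Fin 8 → Set) (e : Seed z) : Set where
  field
    allowed         : ∀ t k c → Allowed (proj₂ (e t k c))
    cover-injective : ∀ s → Injective _≡_ _≡_ (cover e s)
    cover-onto      : ∀ s x b → Allowed b → ∃[ u ] cover e s u ≡ (x , b)
    row-x           : ∀ t k → 4 ∣ ΣF (xcoord e t k) + 2 * carry t
    row-b           : ∀ t k → 8 ∣ ΣF (bcoord e t k)
    column-x₀       : ∀ k c → 4 ∣ xcoord e c0 k c + (xcoord e c1 k c + (xcoord e c-1 k c + 1))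
    column-b₀       : ∀ k c → 8 ∣ bcoord e c0 k c + (bcoord e c1 k c + bcoord e c-1 k c)
    column-x        : ∀ k c → 4 ∣ xcoord e c+ k c + (xcoord e c- k c + 1)
    column-b        : ∀ k c → 8 ∣ bcoord e c+ k c + bcoord e c- k c

module FromSeed {z : ℕ} {Allowed : Fin 8 → Set} {e : Seed z}
                (seed : IsSeed Allowed e) (m : ℕ) where

  open IsSeed seed

  n p : ℕ
  n = suc m
  p = suc (n + n)

  embed : Label n → Fin 4 × Fin 8 → Grp (4 * p) 8
  embed l (x , b) = combine x (residue l) , b

  entry : Fin z → Label n → Fin 4 → Grp (4 * p) 8
  entry k l c = embed (negateIf (negatedColumn c) l) (e (class l) k c)

  array : Fin z → Fin p → Fin 4 → Grp (4 * p) 8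
  array k y c = entry k (label y) c

  entry-cover : ∀ k l c → entry k l c ≡ embed (negateIf (negatedColumn c) l)
                                               (cover e (class (negateIf (negatedColumn c) l)) (k , c))
  entry-cover k l c = cong (λ t → embed (negateIf ν l) (e t k c)) (sym (begin
    negateIfᶜ ν (class (negateIf ν l))  ≡⟨ cong (negateIfᶜ ν) (class-negateIf ν l) ⟩
    negateIfᶜ ν (negateIfᶜ ν (class l)) ≡⟨ negateIfᶜ-involutive ν (class l) ⟩
    class l                             ∎))
    where
    open ≡-Reasoning
    ν = negatedColumn c

  toℕ-entry : ∀ k l c → toℕ (proj₁ (entry k l c))
                        ≡ p * xcoord e (class l) k c + toℕ (residue (negateIf (negatedColumn c) l))
  toℕ-entry k l c = toℕ-combine (proj₁ (e (class l) k c)) (residue (negateIf (negatedColumn c) l))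

  embed-injective : ∀ {l l′ u u′} → embed l u ≡ embed l′ u′ → l ≡ l′ × u ≡ u′
  embed-injective {l} {l′} {x , _} {x′ , _} eq
    with combine-injective x (residue l) x′ (residue l′) (cong proj₁ eq)
  ... | x≡x′ , rl≡rl′ = residue-injective rl≡rl′ , cong₂ _,_ x≡x′ (cong proj₂ eq)

  array-injective : Injective _≡_ _≡_
    (λ (c : Cell p 4 z) → array (proj₁ c) (proj₁ (proj₂ c)) (proj₂ (proj₂ c)))
  array-injective {k , y , c} {k′ , y′ , c′} eq
    with embed-injective (trans (sym (entry-cover k (label y) c)) (trans eq (entry-cover k′ (label y′) c′)))
  ... | l≡l′ , u≡u′
    with cover-injective _ (trans u≡u′ (cong (λ l → cover e (class l) (k′ , c′)) (sym l≡l′)))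
  ... | refl = cong (λ y → k , y , c) (label-injective (negateIf-injective (negatedColumn c) l≡l′))

  array-onto : (g : Grp (4 * p) 8) → Allowed (proj₂ g) →
    Σ (Cell p 4 z) λ c → array (proj₁ c) (proj₁ (proj₂ c)) (proj₂ (proj₂ c)) ≡ g
  array-onto (a , b) allowed-b with combine-surjective {4} {p} a
  ... | x , y₀ , refl with cover-onto (class (label y₀)) x b allowed-b
  ... | (k , c) , covered = (k , residue l′ , c) , (begin
    entry k (label (residue l′)) c
      ≡⟨ cong (λ l → entry k l c) (label-residue l′) ⟩
    entry k l′ c
      ≡⟨ entry-cover k l′ c ⟩
    embed (negateIf ν l′) (cover e (class (negateIf ν l′)) (k , c))
      ≡⟨ cong (λ l → embed l (cover e (class l) (k , c))) (negateIf-involutive ν l₀) ⟩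
    embed l₀ (cover e (class l₀) (k , c))
      ≡⟨ cong (embed l₀) covered ⟩
    combine x (residue (label y₀)) , b
      ≡⟨ cong (λ y → combine x y , b) (residue-label y₀) ⟩
    combine x y₀ , b ∎)
    where
    open ≡-Reasoning
    ν = negatedColumn c
    l₀ = label y₀
    l′ = negateIf ν l₀

  row-sums : ∀ k y → SumsToZero (λ c → array k y c)
  row-sums k y =
    subst (4 * p ∣_) (sym (ΣF-cong (toℕ-entry k l)))
      (row-sum-∣ l (xcoord e (class l) k) (row-x (class l) k)) ,
    row-b (class l) k
    where l = label y

  column-sums : ∀ k c → SumsToZero (λ y → array k y c)
  column-sums k c =
    subst (4 * p ∣_) (sym (ΣF-cong (λ y → toℕ-entry k (label y) c)))
      (column-sum-∣ F (∣-scale p (column-x₀ k c) first-rows) (λ i → ∣-scale p (column-x k c) (row-pair i))) ,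
    column-sum-∣ {m} (λ l → bcoord e (class l) k c) (column-b₀ k c) (λ _ → column-b k c)
    where
    ν = negatedColumn c
    F : Label n → ℕ
    F l = p * xcoord e (class l) k c + toℕ (residue (negateIf ν l))
    first-rows : F origin + (F (plus zero) + F (minus zero))
                 ≡ (xcoord e c0 k c + (xcoord e c1 k c + (xcoord e c-1 k c + 1))) * p
    first-rows = trans (cong (λ l → p * xcoord e c0 k c + toℕ (residue l) + (F (plus zero) + F (minus zero)))
                             (negateIf-origin ν))
                       (origin-pair-sum (xcoord e c0 k c) (xcoord e c1 k c) (xcoord e c-1 k c)
                                        (residue-negateIf-pair ν zero))
    row-pair : ∀ i → F (plus (suc i)) + F (minus (suc i)) ≡ (xcoord e c+ k c + (xcoord e c- k c + 1)) * p
    row-pair i = pair-sum (xcoord e c+ k c) (xcoord e c- k c) (residue-negateIf-pair ν (suc i))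

  imrs : IMRS (4 * p) 8 (λ g → Allowed (proj₂ g)) p 4 z
  imrs = array , (λ k y c → allowed (class (label y)) k c) , array-injective , array-onto
       , row-sums , column-sums

all-classes? : {P : Class → Set} → (∀ t → Dec (P t)) → Dec (∀ t → P t)
all-classes? P? =
  map′ (λ { (p0 , p1 , p-1 , p+ , p-) → λ { c0 → p0 ; c1 → p1 ; c-1 → p-1 ; c+ → p+ ; c- → p- } })
       (λ ∀P → ∀P c0 , ∀P c1 , ∀P c-1 , ∀P c+ , ∀P c-)
       (P? c0 ×-dec P? c1 ×-dec P? c-1 ×-dec P? c+ ×-dec P? c-)

all-pairs? : ∀ {a b} {P : Fin a × Fin b → Set} → (∀ u → Dec (P u)) → Dec (∀ u → P u)
all-pairs? P? = map′ (λ ∀P (i , j) → ∀P i j) (λ ∀P i j → ∀P (i , j)) (all? λ i → all? λ j → P? (i , j))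

any-pair? : ∀ {a b} {P : Fin a × Fin b → Set} → (∀ u → Dec (P u)) → Dec (∃[ u ] P u)
any-pair? P? = map′ (λ { (i , j , Pij) → (i , j) , Pij }) (λ { ((i , j) , Pij) → i , j , Pij })
                    (any? λ i → any? λ j → P? (i , j))

module SeedCheck {z : ℕ} {Allowed : Fin 8 → Set} (Allowed? : ∀ b → Dec (Allowed b)) (e : Seed z) where

  private
    _≟ₑ_ : DecidableEquality (Fin 4 × Fin 8)
    _≟ₑ_ = ≡-dec _≟_ _≟_
    _≟ᵢ_ : DecidableEquality (Fin z × Fin 4)
    _≟ᵢ_ = ≡-dec _≟_ _≟_

  allowed? : Dec (∀ t k c → Allowed (proj₂ (e t k c)))
  allowed? = all-classes? λ t → all? λ k → all? λ c → Allowed? (proj₂ (e t k c))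

  cover-injective? : Dec (∀ s u v → cover e s u ≡ cover e s v → u ≡ v)
  cover-injective? = all-classes? λ s → all-pairs? λ u → all-pairs? λ v →
                       (cover e s u ≟ₑ cover e s v) →-dec (u ≟ᵢ v)

  cover-onto? : Dec (∀ s x b → Allowed b → ∃[ u ] cover e s u ≡ (x , b))
  cover-onto? = all-classes? λ s → all? λ x → all? λ b →
                  Allowed? b →-dec any-pair? λ u → cover e s u ≟ₑ (x , b)

  row-x? : Dec (∀ t k → 4 ∣ ΣF (xcoord e t k) + 2 * carry t)
  row-x? = all-classes? λ t → all? λ k → 4 ∣? _

  row-b? : Dec (∀ t k → 8 ∣ ΣF (bcoord e t k))
  row-b? = all-classes? λ t → all? λ k → 8 ∣? _

  column-x₀? : Dec (∀ k c → 4 ∣ xcoord e c0 k c + (xcoord e c1 k c + (xcoord e c-1 k c + 1)))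
  column-x₀? = all? λ k → all? λ c → 4 ∣? _

  column-b₀? : Dec (∀ k c → 8 ∣ bcoord e c0 k c + (bcoord e c1 k c + bcoord e c-1 k c))
  column-b₀? = all? λ k → all? λ c → 8 ∣? _

  column-x? : Dec (∀ k c → 4 ∣ xcoord e c+ k c + (xcoord e c- k c + 1))
  column-x? = all? λ k → all? λ c → 4 ∣? _

  column-b? : Dec (∀ k c → 8 ∣ bcoord e c+ k c + bcoord e c- k c)
  column-b? = all? λ k → all? λ c → 8 ∣? _

  isSeed : {_ : True allowed?} {_ : True cover-injective?} {_ : True cover-onto?}
           {_ : True row-x?} {_ : True row-b?} {_ : True column-x₀?} {_ : True column-b₀?}
           {_ : True column-x?} {_ : True column-b?} → IsSeed Allowed e
  isSeed {al} {inj} {onto} {rx} {rb} {cx₀} {cb₀} {cx} {cb} = record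
    { allowed         = toWitness al
    ; cover-injective = λ s {u} {v} → toWitness inj s u v
    ; cover-onto      = toWitness onto
    ; row-x           = toWitness rx
    ; row-b           = toWitness rb
    ; column-x₀       = toWitness cx₀
    ; column-b₀       = toWitness cb₀
    ; column-x        = toWitness cx
    ; column-b        = toWitness cb
    }

Table : ℕ → Set
Table z = Vec (Vec (Fin 4 × Fin 8) 4) z

-- Row k of the table of class t lists the entries of array k in a row of class t.
fromTable : ∀ {z} → (Class → Table z) → Seed z
fromTable T t k c = lookup (lookup (T t) k) c

fullTable : Class → Table 8
fullTable c0 =
    ((# 0 , # 0) ∷ (# 0 , # 4) ∷ (# 2 , # 0) ∷ (# 2 , # 4) ∷ [])
  ∷ ((# 2 , # 3) ∷ (# 1 , # 7) ∷ (# 2 , # 5) ∷ (# 3 , # 1) ∷ [])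
  ∷ ((# 0 , # 1) ∷ (# 2 , # 2) ∷ (# 0 , # 7) ∷ (# 2 , # 6) ∷ [])
  ∷ ((# 1 , # 3) ∷ (# 1 , # 2) ∷ (# 3 , # 5) ∷ (# 3 , # 6) ∷ [])
  ∷ ((# 1 , # 0) ∷ (# 1 , # 5) ∷ (# 3 , # 0) ∷ (# 3 , # 3) ∷ [])
  ∷ ((# 1 , # 4) ∷ (# 2 , # 1) ∷ (# 3 , # 4) ∷ (# 2 , # 7) ∷ [])
  ∷ ((# 1 , # 1) ∷ (# 0 , # 2) ∷ (# 3 , # 7) ∷ (# 0 , # 6) ∷ [])
  ∷ ((# 1 , # 6) ∷ (# 0 , # 3) ∷ (# 3 , # 2) ∷ (# 0 , # 5) ∷ [])
  ∷ []
fullTable c1 =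
    ((# 3 , # 5) ∷ (# 0 , # 1) ∷ (# 3 , # 6) ∷ (# 0 , # 4) ∷ [])
  ∷ ((# 0 , # 5) ∷ (# 0 , # 2) ∷ (# 2 , # 1) ∷ (# 0 , # 0) ∷ [])
  ∷ ((# 1 , # 7) ∷ (# 2 , # 4) ∷ (# 2 , # 6) ∷ (# 1 , # 7) ∷ [])
  ∷ ((# 2 , # 6) ∷ (# 1 , # 5) ∷ (# 2 , # 2) ∷ (# 1 , # 3) ∷ [])
  ∷ ((# 2 , # 3) ∷ (# 1 , # 6) ∷ (# 1 , # 2) ∷ (# 2 , # 5) ∷ [])
  ∷ ((# 3 , # 3) ∷ (# 1 , # 1) ∷ (# 3 , # 0) ∷ (# 3 , # 4) ∷ [])
  ∷ ((# 0 , # 4) ∷ (# 3 , # 4) ∷ (# 3 , # 7) ∷ (# 0 , # 1) ∷ [])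
  ∷ ((# 0 , # 6) ∷ (# 0 , # 0) ∷ (# 1 , # 6) ∷ (# 1 , # 4) ∷ [])
  ∷ []
fullTable c-1 =
    ((# 0 , # 3) ∷ (# 3 , # 3) ∷ (# 2 , # 2) ∷ (# 1 , # 0) ∷ [])
  ∷ ((# 1 , # 0) ∷ (# 2 , # 7) ∷ (# 3 , # 2) ∷ (# 0 , # 7) ∷ [])
  ∷ ((# 2 , # 0) ∷ (# 3 , # 2) ∷ (# 1 , # 3) ∷ (# 0 , # 3) ∷ [])
  ∷ ((# 0 , # 7) ∷ (# 1 , # 1) ∷ (# 2 , # 1) ∷ (# 3 , # 7) ∷ [])
  ∷ ((# 0 , # 5) ∷ (# 1 , # 5) ∷ (# 3 , # 6) ∷ (# 2 , # 0) ∷ [])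
  ∷ ((# 3 , # 1) ∷ (# 0 , # 6) ∷ (# 1 , # 4) ∷ (# 2 , # 5) ∷ [])
  ∷ ((# 2 , # 3) ∷ (# 0 , # 2) ∷ (# 1 , # 2) ∷ (# 3 , # 1) ∷ [])
  ∷ ((# 2 , # 4) ∷ (# 3 , # 5) ∷ (# 3 , # 0) ∷ (# 2 , # 7) ∷ [])
  ∷ []
fullTable c+ =
    ((# 0 , # 0) ∷ (# 2 , # 4) ∷ (# 1 , # 0) ∷ (# 3 , # 4) ∷ [])
  ∷ ((# 0 , # 1) ∷ (# 2 , # 5) ∷ (# 1 , # 7) ∷ (# 3 , # 3) ∷ [])
  ∷ ((# 0 , # 2) ∷ (# 2 , # 6) ∷ (# 1 , # 6) ∷ (# 3 , # 2) ∷ [])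
  ∷ ((# 0 , # 3) ∷ (# 2 , # 7) ∷ (# 1 , # 5) ∷ (# 3 , # 1) ∷ [])
  ∷ ((# 1 , # 0) ∷ (# 3 , # 4) ∷ (# 0 , # 0) ∷ (# 2 , # 4) ∷ [])
  ∷ ((# 1 , # 1) ∷ (# 3 , # 5) ∷ (# 0 , # 7) ∷ (# 2 , # 3) ∷ [])
  ∷ ((# 1 , # 2) ∷ (# 3 , # 6) ∷ (# 0 , # 6) ∷ (# 2 , # 2) ∷ [])
  ∷ ((# 1 , # 3) ∷ (# 3 , # 7) ∷ (# 0 , # 5) ∷ (# 2 , # 1) ∷ [])
  ∷ []
fullTable c- =
    ((# 3 , # 0) ∷ (# 1 , # 4) ∷ (# 2 , # 0) ∷ (# 0 , # 4) ∷ [])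
  ∷ ((# 3 , # 7) ∷ (# 1 , # 3) ∷ (# 2 , # 1) ∷ (# 0 , # 5) ∷ [])
  ∷ ((# 3 , # 6) ∷ (# 1 , # 2) ∷ (# 2 , # 2) ∷ (# 0 , # 6) ∷ [])
  ∷ ((# 3 , # 5) ∷ (# 1 , # 1) ∷ (# 2 , # 3) ∷ (# 0 , # 7) ∷ [])
  ∷ ((# 2 , # 0) ∷ (# 0 , # 4) ∷ (# 3 , # 0) ∷ (# 1 , # 4) ∷ [])
  ∷ ((# 2 , # 7) ∷ (# 0 , # 3) ∷ (# 3 , # 1) ∷ (# 1 , # 5) ∷ [])
  ∷ ((# 2 , # 6) ∷ (# 0 , # 2) ∷ (# 3 , # 2) ∷ (# 1 , # 6) ∷ [])
  ∷ ((# 2 , # 5) ∷ (# 0 , # 1) ∷ (# 3 , # 3) ∷ (# 1 , # 7) ∷ [])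
  ∷ []

puncturedTable : Class → Table 6
puncturedTable c0 =
    ((# 1 , # 6) ∷ (# 2 , # 3) ∷ (# 3 , # 2) ∷ (# 2 , # 5) ∷ [])
  ∷ ((# 0 , # 1) ∷ (# 1 , # 7) ∷ (# 0 , # 7) ∷ (# 3 , # 1) ∷ [])
  ∷ ((# 1 , # 3) ∷ (# 1 , # 5) ∷ (# 3 , # 5) ∷ (# 3 , # 3) ∷ [])
  ∷ ((# 1 , # 1) ∷ (# 2 , # 2) ∷ (# 3 , # 7) ∷ (# 2 , # 6) ∷ [])
  ∷ ((# 1 , # 2) ∷ (# 0 , # 2) ∷ (# 3 , # 6) ∷ (# 0 , # 6) ∷ [])
  ∷ ((# 2 , # 1) ∷ (# 0 , # 3) ∷ (# 2 , # 7) ∷ (# 0 , # 5) ∷ [])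
  ∷ []
puncturedTable c1 =
    ((# 3 , # 7) ∷ (# 3 , # 2) ∷ (# 2 , # 5) ∷ (# 2 , # 2) ∷ [])
  ∷ ((# 2 , # 2) ∷ (# 0 , # 2) ∷ (# 3 , # 2) ∷ (# 1 , # 2) ∷ [])
  ∷ ((# 2 , # 6) ∷ (# 1 , # 2) ∷ (# 3 , # 6) ∷ (# 0 , # 2) ∷ [])
  ∷ ((# 1 , # 1) ∷ (# 2 , # 7) ∷ (# 0 , # 3) ∷ (# 3 , # 5) ∷ [])
  ∷ ((# 0 , # 5) ∷ (# 2 , # 3) ∷ (# 1 , # 7) ∷ (# 3 , # 1) ∷ [])
  ∷ ((# 1 , # 6) ∷ (# 1 , # 7) ∷ (# 0 , # 6) ∷ (# 0 , # 5) ∷ [])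
  ∷ []
puncturedTable c-1 =
    ((# 3 , # 3) ∷ (# 2 , # 3) ∷ (# 2 , # 1) ∷ (# 3 , # 1) ∷ [])
  ∷ ((# 1 , # 5) ∷ (# 2 , # 7) ∷ (# 0 , # 7) ∷ (# 3 , # 5) ∷ [])
  ∷ ((# 0 , # 7) ∷ (# 1 , # 1) ∷ (# 1 , # 5) ∷ (# 0 , # 3) ∷ [])
  ∷ ((# 1 , # 6) ∷ (# 3 , # 7) ∷ (# 0 , # 6) ∷ (# 2 , # 5) ∷ [])
  ∷ ((# 2 , # 1) ∷ (# 1 , # 3) ∷ (# 3 , # 3) ∷ (# 0 , # 1) ∷ [])
  ∷ ((# 0 , # 1) ∷ (# 2 , # 6) ∷ (# 1 , # 3) ∷ (# 3 , # 6) ∷ [])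
  ∷ []
puncturedTable c+ =
    ((# 0 , # 1) ∷ (# 2 , # 5) ∷ (# 1 , # 7) ∷ (# 3 , # 3) ∷ [])
  ∷ ((# 0 , # 2) ∷ (# 2 , # 6) ∷ (# 1 , # 6) ∷ (# 3 , # 2) ∷ [])
  ∷ ((# 0 , # 3) ∷ (# 2 , # 7) ∷ (# 1 , # 5) ∷ (# 3 , # 1) ∷ [])
  ∷ ((# 1 , # 1) ∷ (# 3 , # 5) ∷ (# 0 , # 7) ∷ (# 2 , # 3) ∷ [])
  ∷ ((# 1 , # 2) ∷ (# 3 , # 6) ∷ (# 0 , # 6) ∷ (# 2 , # 2) ∷ [])
  ∷ ((# 1 , # 3) ∷ (# 3 , # 7) ∷ (# 0 , # 5) ∷ (# 2 , # 1) ∷ [])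
  ∷ []
puncturedTable c- =
    ((# 3 , # 7) ∷ (# 1 , # 3) ∷ (# 2 , # 1) ∷ (# 0 , # 5) ∷ [])
  ∷ ((# 3 , # 6) ∷ (# 1 , # 2) ∷ (# 2 , # 2) ∷ (# 0 , # 6) ∷ [])
  ∷ ((# 3 , # 5) ∷ (# 1 , # 1) ∷ (# 2 , # 3) ∷ (# 0 , # 7) ∷ [])
  ∷ ((# 2 , # 7) ∷ (# 0 , # 3) ∷ (# 3 , # 1) ∷ (# 1 , # 5) ∷ [])
  ∷ ((# 2 , # 6) ∷ (# 0 , # 2) ∷ (# 3 , # 2) ∷ (# 1 , # 6) ∷ [])
  ∷ ((# 2 , # 5) ∷ (# 0 , # 1) ∷ (# 3 , # 3) ∷ (# 1 , # 7) ∷ [])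
  ∷ []
OffSubgroup : Fin 8 → Set
OffSubgroup b = (toℕ b ≢ 0) × (toℕ b ≢ 4)

fullSeed : IsSeed (λ _ → ⊤) (fromTable fullTable)
fullSeed = SeedCheck.isSeed (λ _ → yes tt) (fromTable fullTable)

puncturedSeed : IsSeed OffSubgroup (fromTable puncturedTable)
puncturedSeed =
  SeedCheck.isSeed (λ b → ¬? (toℕ b ℕ.≟ 0) ×-dec ¬? (toℕ b ℕ.≟ 4)) (fromTable puncturedTable)

odd⇒≡1+n+n : ∀ q → ¬ (2 ∣ q) → ∃[ n ] q ≡ suc (n + n)
odd⇒≡1+n+n zero          2∤q = ⊥-elim (2∤q (2 ∣0))
odd⇒≡1+n+n (suc zero)    2∤q = 0 , refl
odd⇒≡1+n+n (suc (suc q)) 2∤q with odd⇒≡1+n+n q (2∤q ∘ ∣m∣n⇒∣m+n (∣-refl {2}))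
... | n , refl = suc n , cong (λ t → suc (suc t)) (sym (+-suc n n))

lemma4p4 : (p : ℕ) → Prime p → ¬ (2 ∣ p) →
    IMRS (4 * p) 8 NotIn04 p 4 6 × MRS (4 * p) 8 p 4 8
lemma4p4 p p-prime 2∤p with odd⇒≡1+n+n p 2∤p
... | zero  , refl = ⊥-elim (¬prime[1] p-prime)
... | suc m , refl = FromSeed.imrs puncturedSeed m , FromSeed.imrs fullSeed m
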